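{- (ii) Let $K\ge1$ and $L\ge2$ be integers, $0\le k\le K-1$ and $0\le\ell\le L-1$. Then the number of multi-indices $\gamma=(\gamma_p)_{0\le p\le L-1,\,p\ne\ell}\in\mathbb{Z}_{\ge0}^{L-1}$ with $\sum_{p\ne\ell}\gamma_p=K-k-1$ is at most $2^{K+L-3}\sqrt{2/L}$. -}

module Defs where

open import Data.Nat using (ℕ)
open import Data.Vec using (Vec; sum)
open import Relation.Binary.PropositionalEquality using (_≡_)

-- A multi-index γ = (γ_p)_{p ≠ ℓ} ∈ ℤ_{≥0}^{L-1} is represented as a vector of
-- n = L - 1 naturals (the L-1 indices p ≠ ℓ listed in increasing order).
-- It has total degree m when Σ_p γ_p = m.
HasDegree : {n : ℕ} → ℕ → Vec ℕ n → Set
HasDegree m γ = sum γ ≡ m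

{-# OPTIONS --safe #-}
-- The multi-indices in question are the compositions of m = K - k - 1 into a + 1 = L - 1
-- parts, of which there are C(a + m, a); so it suffices that (n + 2) C(n, a)² ≤ 2 · 4ⁿ.
-- Both on the diagonal, where C(2a + 2, a + 1) / C(2a, a) = 2(2a + 1)/(a + 1), and when
-- stepping from C(a + b, a) to C(a + b + 1, a) with a ≤ b, where the ratio is (a + b + 1)/(b + 1),
-- the bound propagates thanks to (r + 3) r² ≤ (r + 1)³.  The case a > b is symmetric.
module Submission where

open import Defs
open import Data.Nat
open import Data.Nat.Properties
open import Data.Vec using (Vec; []; _∷_)
open import Data.List using (List; []; _∷_; length; map; _++_; [_])
open import Data.List.Properties using (length-++; length-map; length-++-sucʳ)
import Data.List.Relation.Unary.All as All
open import Data.List.Relation.Unary.Any using (here; there)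
open import Data.List.Relation.Unary.Unique.Propositional using (Unique)
open import Data.List.Relation.Unary.AllPairs using (_∷_)
open import Data.List.Relation.Binary.Subset.Propositional using (_⊆_)
open import Data.List.Membership.Propositional using (_∈_)
open import Data.List.Membership.Propositional.Properties
  using (∈-map⁺; ∈-++⁺ˡ; ∈-++⁺ʳ; ∈-++⁻; ∈-∃++)
open import Data.Product using (_,_)
open import Data.Sum using (inj₁; inj₂)
open import Data.Empty using (⊥-elim)
open import Function.Bundles using (_⇔_; Equivalence)
open import Relation.Binary.PropositionalEquality hiding ([_])
open import Data.Nat.Tactic.RingSolver using (solve-∀)

Unique-⊆⇒length-≤ : ∀ {A : Set} {xs ys : List A} → Unique xs → xs ⊆ ys →
  length xs ≤ length ys
Unique-⊆⇒length-≤ {xs = []} _ _ = z≤n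
Unique-⊆⇒length-≤ {xs = x ∷ xs} (x∉xs ∷ xs!) x∷xs⊆ys
  with us , vs , refl ← ∈-∃++ (x∷xs⊆ys (here refl)) = begin
    suc (length xs)          ≤⟨ s≤s (Unique-⊆⇒length-≤ xs! xs⊆us++vs) ⟩
    suc (length (us ++ vs))  ≡⟨ length-++-sucʳ us x vs ⟨
    length (us ++ x ∷ vs)    ∎
  where
  open ≤-Reasoning
  xs⊆us++vs : xs ⊆ us ++ vs
  xs⊆us++vs z∈xs with ∈-++⁻ us (x∷xs⊆ys (there z∈xs))
  ... | inj₁ z∈us         = ∈-++⁺ˡ z∈us
  ... | inj₂ (here refl)  = ⊥-elim (All.lookup x∉xs z∈xs refl)
  ... | inj₂ (there z∈vs) = ∈-++⁺ʳ us z∈vs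

incrementHead : ∀ {n} → Vec ℕ (suc n) → Vec ℕ (suc n)
incrementHead (x ∷ γ) = suc x ∷ γ

compositions : (n m : ℕ) → List (Vec ℕ n)
compositions zero    zero    = [ [] ]
compositions zero    (suc m) = []
compositions (suc n) zero    = map (0 ∷_) (compositions n zero)
compositions (suc n) (suc m) =
  map (0 ∷_) (compositions n (suc m)) ++ map incrementHead (compositions (suc n) m)

∈-compositions : ∀ n m (γ : Vec ℕ n) → HasDegree m γ → γ ∈ compositions n m
∈-compositions zero    zero    []          _  = here refl
∈-compositions (suc n) zero    (zero ∷ γ)  eq = ∈-map⁺ (0 ∷_) (∈-compositions n zero γ eq)
∈-compositions (suc n) (suc m) (zero ∷ γ)  eq =
  ∈-++⁺ˡ (∈-map⁺ (0 ∷_) (∈-compositions n (suc m) γ eq))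
∈-compositions (suc n) (suc m) (suc x ∷ γ) eq =
  ∈-++⁺ʳ _ (∈-map⁺ incrementHead (∈-compositions (suc n) m (x ∷ γ) (suc-injective eq)))

-- Compositions into a + 1 parts: count a b = C(a + b, a).
count : ℕ → ℕ → ℕ
count a b = length (compositions (suc a) b)

count-zeroˡ : ∀ b → count 0 b ≡ 1
count-zeroˡ zero    = refl
count-zeroˡ (suc b) = trans (length-map incrementHead (compositions 1 b)) (count-zeroˡ b)

count-zeroʳ : ∀ a → count a 0 ≡ 1
count-zeroʳ zero    = refl
count-zeroʳ (suc a) = trans (length-map (0 ∷_) (compositions (suc a) zero)) (count-zeroʳ a)

count-pascal : ∀ a b → count (suc a) (suc b) ≡ count a (suc b) + count (suc a) b
count-pascal a b = begin
  count (suc a) (suc b)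
    ≡⟨ length-++ (map (0 ∷_) (compositions (suc a) (suc b))) ⟩
  length (map (0 ∷_) (compositions (suc a) (suc b)))
    + length (map incrementHead (compositions (suc (suc a)) b))
    ≡⟨ cong₂ _+_ (length-map (0 ∷_) (compositions (suc a) (suc b)))
                 (length-map incrementHead (compositions (suc (suc a)) b)) ⟩
  count a (suc b) + count (suc a) b ∎
  where open ≡-Reasoning

count*factorials : ∀ a b → count a b * (a ! * b !) ≡ (a + b) !
count*factorials zero b = begin
  count 0 b * (1 * b !) ≡⟨ cong (_* (1 * b !)) (count-zeroˡ b) ⟩
  1 * (1 * b !)         ≡⟨ trans (*-identityˡ _) (*-identityˡ _) ⟩
  b !                   ∎
  where open ≡-Reasoning
count*factorials (suc a) zero = begin
  count (suc a) 0 * (suc a ! * 1) ≡⟨ cong (_* (suc a ! * 1)) (count-zeroʳ (suc a)) ⟩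
  1 * (suc a ! * 1)               ≡⟨ trans (*-identityˡ _) (*-identityʳ _) ⟩
  suc a !                         ≡⟨ cong _! (+-identityʳ (suc a)) ⟨
  (suc a + 0) !                   ∎
  where open ≡-Reasoning
count*factorials (suc a) (suc b) = begin
  count (suc a) (suc b) * (suc a ! * suc b !)
    ≡⟨ cong (_* (suc a ! * suc b !)) (count-pascal a b) ⟩
  (count a (suc b) + count (suc a) b) * (suc a ! * suc b !)
    ≡⟨ distribute (count a (suc b)) (count (suc a) b) a b (a !) (b !) ⟩
  suc a * (count a (suc b) * (a ! * suc b !)) + suc b * (count (suc a) b * (suc a ! * b !))
    ≡⟨ cong₂ (λ u v → suc a * u + suc b * v)
             (count*factorials a (suc b)) (count*factorials (suc a) b) ⟩
  suc a * (a + suc b) ! + suc b * (suc a + b) !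
    ≡⟨ cong (λ c → suc a * c ! + suc b * (suc a + b) !) (+-suc a b) ⟩
  suc a * (suc a + b) ! + suc b * (suc a + b) !
    ≡⟨ *-distribʳ-+ ((suc a + b) !) (suc a) (suc b) ⟨
  (suc a + suc b) * (suc a + b) !
    ≡⟨ cong (λ c → (suc a + suc b) * c !) (+-suc a b) ⟨
  (suc a + suc b) ! ∎
  where
  open ≡-Reasoning
  distribute : ∀ u v x y fx fy → (u + v) * ((1 + x) * fx * ((1 + y) * fy)) ≡
    (1 + x) * (u * (fx * ((1 + y) * fy))) + (1 + y) * (v * ((1 + x) * fx * fy))
  distribute = solve-∀

cancel-factorials : ∀ a b {x y} → x * (a ! * b !) ≡ y * (a ! * b !) → x ≡ y
cancel-factorials a b = *-cancelʳ-≡ _ _ (a ! * b !) {{m*n≢0 (a !) (b !) {{a !≢0}} {{b !≢0}}}}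

count-sym : ∀ a b → count a b ≡ count b a
count-sym a b = cancel-factorials a b (begin
  count a b * (a ! * b !) ≡⟨ count*factorials a b ⟩
  (a + b) !               ≡⟨ cong _! (+-comm a b) ⟩
  (b + a) !               ≡⟨ count*factorials b a ⟨
  count b a * (b ! * a !) ≡⟨ cong (count b a *_) (*-comm (b !) (a !)) ⟩
  count b a * (a ! * b !) ∎)
  where open ≡-Reasoning

count-sucʳ : ∀ a b → count a (suc b) * suc b ≡ count a b * suc (a + b)
count-sucʳ a b = cancel-factorials a b (begin
  count a (suc b) * suc b * (a ! * b !)   ≡⟨ shuffle (count a (suc b)) b (a !) (b !) ⟩
  count a (suc b) * (a ! * suc b !)       ≡⟨ count*factorials a (suc b) ⟩
  (a + suc b) !                           ≡⟨ cong _! (+-suc a b) ⟩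
  suc (a + b) * (a + b) !                 ≡⟨ cong (suc (a + b) *_) (count*factorials a b) ⟨
  suc (a + b) * (count a b * (a ! * b !)) ≡⟨ reassociate (suc (a + b)) (count a b) (a ! * b !) ⟩
  count a b * suc (a + b) * (a ! * b !)   ∎)
  where
  open ≡-Reasoning
  shuffle : ∀ x y fa fb → x * (1 + y) * (fa * fb) ≡ x * (fa * ((1 + y) * fb))
  shuffle = solve-∀
  reassociate : ∀ x y z → x * (y * z) ≡ y * x * z
  reassociate = solve-∀

count-sucˡ : ∀ a b → count (suc a) b * suc a ≡ count a b * suc (a + b)
count-sucˡ a b = begin
  count (suc a) b * suc a ≡⟨ cong (_* suc a) (count-sym (suc a) b) ⟩
  count b (suc a) * suc a ≡⟨ count-sucʳ b a ⟩
  count b a * suc (b + a) ≡⟨ cong₂ (λ c n → c * suc n) (count-sym b a) (+-comm b a) ⟩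
  count a b * suc (a + b) ∎
  where open ≡-Reasoning

count-diagonal : ∀ a → count (suc a) (suc a) * suc a ≡ count a a * (2 * suc (a + a))
count-diagonal a = begin
  count (suc a) (suc a) * suc a     ≡⟨ count-sucˡ a (suc a) ⟩
  count a (suc a) * suc (a + suc a) ≡⟨ double (count a (suc a)) a ⟩
  2 * (count a (suc a) * suc a)     ≡⟨ cong (2 *_) (count-sucʳ a a) ⟩
  2 * (count a a * suc (a + a))     ≡⟨ swap (count a a) (suc (a + a)) ⟩
  count a a * (2 * suc (a + a))     ∎
  where
  open ≡-Reasoning
  double : ∀ x n → x * (1 + (n + (1 + n))) ≡ 2 * (x * (1 + n))
  double = solve-∀
  swap : ∀ x y → 2 * (x * y) ≡ x * (2 * y)
  swap = solve-∀

-- Bounded n d says d ≤ 2ⁿ √(2 / (n + 2)), squared to stay in ℕ.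
Bounded : ℕ → ℕ → Set
Bounded n d = (2 + n) * (d * d) ≤ 2 * 4 ^ n

Bounded-step : ∀ n k {x y c e} .{{_ : NonZero c}} → y * c ≡ x * e →
  (2 + (n + k)) * (e * e) ≤ 4 ^ k * ((2 + n) * (c * c)) →
  Bounded n x → Bounded (n + k) y
Bounded-step n k {x} {y} {c} {e} yc≡xe ratio bound =
  *-cancelʳ-≤ _ _ ((2 + n) * (c * c)) {{m*n≢0 (2 + n) (c * c) {{_}} {{m*n≢0 c c}}}} (begin
    (2 + (n + k)) * (y * y) * ((2 + n) * (c * c))  ≡⟨ square-ratio (2 + (n + k)) y c (2 + n) ⟩
    (2 + (n + k)) * ((y * c) * (y * c)) * (2 + n)  ≡⟨ cong (λ z → (2 + (n + k)) * (z * z) * (2 + n)) yc≡xe ⟩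
    (2 + (n + k)) * ((x * e) * (x * e)) * (2 + n)  ≡⟨ unsquare-ratio (2 + (n + k)) x e (2 + n) ⟩
    (2 + (n + k)) * (e * e) * ((2 + n) * (x * x))  ≤⟨ *-mono-≤ ratio bound ⟩
    4 ^ k * ((2 + n) * (c * c)) * (2 * 4 ^ n)      ≡⟨ collect (4 ^ k) ((2 + n) * (c * c)) (4 ^ n) ⟩
    2 * (4 ^ n * 4 ^ k) * ((2 + n) * (c * c))      ≡⟨ cong (λ z → 2 * z * ((2 + n) * (c * c))) (^-distribˡ-+-* 4 n k) ⟨
    2 * 4 ^ (n + k) * ((2 + n) * (c * c))          ∎)
  where
  open ≤-Reasoning
  square-ratio : ∀ p y c q → p * (y * y) * (q * (c * c)) ≡ p * ((y * c) * (y * c)) * q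
  square-ratio = solve-∀
  unsquare-ratio : ∀ p x e q → p * ((x * e) * (x * e)) * q ≡ p * (e * e) * (q * (x * x))
  unsquare-ratio = solve-∀
  collect : ∀ u v w → u * v * (2 * w) ≡ 2 * (w * u) * v
  collect = solve-∀

[3+n]n²≤[1+n]³ : ∀ n → (3 + n) * (n * n) ≤ suc n * (suc n * suc n)
[3+n]n²≤[1+n]³ n = begin
  (3 + n) * (n * n)                 ≤⟨ m≤m+n _ (3 * n + 1) ⟩
  (3 + n) * (n * n) + (3 * n + 1)   ≡⟨ cube n ⟩
  suc n * (suc n * suc n)           ∎
  where
  open ≤-Reasoning
  cube : ∀ n → (3 + n) * (n * n) + (3 * n + 1) ≡ suc n * (suc n * suc n)
  cube = solve-∀

count-bounded-diagonal : ∀ a → Bounded (a + a) (count a a)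
count-bounded-diagonal zero    = ≤-refl
count-bounded-diagonal (suc a) =
  subst (λ n → Bounded n (count (suc a) (suc a))) (shift a)
    (Bounded-step (a + a) 2 {count a a} {count (suc a) (suc a)} {suc a} {2 * r}
      (count-diagonal a) ratio (count-bounded-diagonal a))
  where
  open ≤-Reasoning
  r = suc (a + a)
  ratio : (2 + (a + a + 2)) * ((2 * r) * (2 * r)) ≤ 16 * ((2 + (a + a)) * (suc a * suc a))
  ratio = begin
    (2 + (a + a + 2)) * ((2 * r) * (2 * r))   ≡⟨ lhs a ⟩
    4 * ((3 + r) * (r * r))                   ≤⟨ *-monoʳ-≤ 4 ([3+n]n²≤[1+n]³ r) ⟩
    4 * (suc r * (suc r * suc r))             ≡⟨ rhs a ⟩
    16 * ((2 + (a + a)) * (suc a * suc a))    ∎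
    where
    lhs : ∀ a → (2 + (a + a + 2)) * ((2 * suc (a + a)) * (2 * suc (a + a)))
              ≡ 4 * ((3 + suc (a + a)) * (suc (a + a) * suc (a + a)))
    lhs = solve-∀
    rhs : ∀ a → 4 * (suc (suc (a + a)) * (suc (suc (a + a)) * suc (suc (a + a))))
              ≡ 16 * ((2 + (a + a)) * (suc a * suc a))
    rhs = solve-∀
  shift : ∀ a → a + a + 2 ≡ suc a + suc a
  shift = solve-∀

count-bounded-sucʳ : ∀ {a b} → a ≤ b → Bounded (a + b) (count a b) → Bounded (a + suc b) (count a (suc b))
count-bounded-sucʳ {a} {b} a≤b bound =
  subst (λ n → Bounded n (count a (suc b))) (shift a b)
    (Bounded-step (a + b) 1 {count a b} {count a (suc b)} {suc b} {r} (count-sucʳ a b) ratio bound)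
  where
  open ≤-Reasoning
  r = suc (a + b)
  2+a+b≤2[1+b] : 2 + (a + b) ≤ 2 * suc b
  2+a+b≤2[1+b] = begin
    2 + (a + b) ≤⟨ +-monoʳ-≤ 2 (+-monoˡ-≤ b a≤b) ⟩
    2 + (b + b) ≡⟨ double b ⟩
    2 * suc b   ∎
    where
    double : ∀ b → 2 + (b + b) ≡ 2 * suc b
    double = solve-∀
  ratio : (2 + (a + b + 1)) * (r * r) ≤ 4 ^ 1 * ((2 + (a + b)) * (suc b * suc b))
  ratio = begin
    (2 + (a + b + 1)) * (r * r)                  ≡⟨ cong (λ n → (2 + n) * (r * r)) (+-comm (a + b) 1) ⟩
    (2 + r) * (r * r)                            ≤⟨ *-monoˡ-≤ (r * r) (n≤1+n (2 + r)) ⟩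
    (3 + r) * (r * r)                            ≤⟨ [3+n]n²≤[1+n]³ r ⟩
    (2 + (a + b)) * ((2 + (a + b)) * (2 + (a + b)))
      ≤⟨ *-monoʳ-≤ (2 + (a + b)) (*-mono-≤ 2+a+b≤2[1+b] 2+a+b≤2[1+b]) ⟩
    (2 + (a + b)) * ((2 * suc b) * (2 * suc b))  ≡⟨ factor (2 + (a + b)) b ⟩
    4 * ((2 + (a + b)) * (suc b * suc b))        ∎
    where
    factor : ∀ p b → p * ((2 * suc b) * (2 * suc b)) ≡ 4 * (p * (suc b * suc b))
    factor = solve-∀
  shift : ∀ a b → a + b + 1 ≡ a + suc b
  shift = solve-∀

count-bounded-≤′ : ∀ {a b} → a ≤′ b → Bounded (a + b) (count a b)
count-bounded-≤′ {a} ≤′-refl           = count-bounded-diagonal a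
count-bounded-≤′     (≤′-step a≤′b) = count-bounded-sucʳ (≤′⇒≤ a≤′b) (count-bounded-≤′ a≤′b)

count-bounded : ∀ a b → Bounded (a + b) (count a b)
count-bounded a b with ≤-total a b
... | inj₁ a≤b = count-bounded-≤′ (≤⇒≤′ a≤b)
... | inj₂ b≤a = subst₂ Bounded (+-comm b a) (count-sym b a) (count-bounded-≤′ (≤⇒≤′ b≤a))

2*4^n≡2^[1+2n] : ∀ n → 2 * 4 ^ n ≡ 2 ^ suc (2 * n)
2*4^n≡2^[1+2n] n = cong (2 *_) (^-*-assoc 2 2 n)

mainTheorem7 : (K L k ℓ : ℕ) → 1 ≤ K → 2 ≤ L → k < K → ℓ < L →
    (xs : List (Vec ℕ (L ∸ 1))) → Unique xs →
    (∀ γ → (γ ∈ xs) ⇔ HasDegree (K ∸ k ∸ 1) γ) →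
    L * (length xs ^ 2) ≤ 2 ^ (2 * (K + L) ∸ 5)
mainTheorem7 (suc K) (suc (suc a)) k ℓ _ (s≤s (s≤s _)) _ _ xs xs! xs⇔degree = begin
  (2 + a) * (N ^ 2)                       ≡⟨ cong (λ z → (2 + a) * (N * z)) (*-identityʳ N) ⟩
  (2 + a) * (N * N)                       ≤⟨ *-mono-≤ (+-monoʳ-≤ 2 (m≤m+n a m)) (*-mono-≤ N≤count N≤count) ⟩
  (2 + (a + m)) * (count a m * count a m) ≤⟨ count-bounded a m ⟩
  2 * 4 ^ (a + m)                         ≤⟨ *-monoʳ-≤ 2 (^-monoʳ-≤ 4 (+-monoʳ-≤ a m≤K)) ⟩
  2 * 4 ^ (a + K)                         ≡⟨ 2*4^n≡2^[1+2n] (a + K) ⟩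
  2 ^ suc (2 * (a + K))                   ≡⟨ cong (2 ^_) (exponent K a) ⟨
  2 ^ (2 * (suc K + suc (suc a)) ∸ 5)     ∎
  where
  open ≤-Reasoning
  N = length xs
  m = suc K ∸ k ∸ 1
  m≤K : m ≤ K
  m≤K = ∸-monoˡ-≤ 1 (m∸n≤m (suc K) k)
  N≤count : N ≤ count a m
  N≤count = Unique-⊆⇒length-≤ xs! (λ {γ} γ∈xs → ∈-compositions (suc a) m γ (Equivalence.to (xs⇔degree γ) γ∈xs))
  exponent : ∀ K a → 2 * (suc K + suc (suc a)) ∸ 5 ≡ suc (2 * (a + K))
  exponent K a = trans (cong (_∸ 5) (expand K a)) (m+n∸m≡n 5 (suc (2 * (a + K))))
    where
    expand : ∀ K a → 2 * (suc K + suc (suc a)) ≡ 5 + suc (2 * (a + K))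
    expand = solve-∀
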